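{- Let $G$ be a graph with an $(\alpha,\beta)$-linkage $\mathcal{P}=\{p_i\}_{i=1}^t$. If $\mathcal{P}$ is $(\alpha,\beta)$-rigid, then no path in $\mathcal{P}$ has a chord and $G$ does not have an $X$ $(\alpha,\beta)$-linkage minor for $\mathcal{P}$. Conversely, if $\mathcal{P}$ is a spanning chordless $(\alpha,\beta)$-linkage of order $2$ with no $X$ $(\alpha,\beta)$-linkage minor, then $\mathcal{P}$ is $(\alpha,\beta)$-rigid.
   Context: A linkage in $G$ is a subgraph whose components are paths (a single vertex counts as a path); its order is the number of paths; spanning means it contains all vertices of $G$. For $\alpha,\beta\subseteq V(G)$, $\mathcal{P}$ is an $(\alpha,\beta)$-linkage if $\alpha$ consists of one endpoint of each path and $\beta$ of the other endpoints (a one-vertex path has its vertex in both); write $\alpha_i\in\alpha$, $\beta_i\in\beta$ for the endpoints of $p_i$. $\mathcal{P}$ is $(\alpha,\beta)$-rigid if it is the unique $(\alpha,\beta)$-linkage in $G$. A chord of $\mathcal{P}$ is an edge of $G$ not in $\mathcal{P}$ with both endpoints on a single path of $\mathcal{P}$; $\mathcal{P}$ is chordless if it has no chord. Edges of $G$ in $\mathcal{P}$ are path edges; edges of $G$ not in $\mathcal{P}$ that are not chords are rung edges. For a chordless linkage, a linkage minor is a minor of $G$ obtained by possibly contracting some path edges and possibly deleting some rung edges; an $(\alpha,\beta)$-linkage minor is a linkage minor in which the vertices of $\alpha$ and $\beta$ retain their labels. $G$ has an $X$ $(\alpha,\beta)$-linkage minor for $\mathcal{P}$ if for two paths $p_k,p_\ell$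 of $\mathcal{P}$ there is an $(\alpha,\beta)$-linkage minor for $p_k,p_\ell$ that is isomorphic to the $4$-cycle $C_4$ (on the vertices labeled $\alpha_k,\beta_k,\alpha_\ell,\beta_\ell$, the paths becoming the edges $\alpha_k\beta_k$ and $\alpha_\ell\beta_\ell$) with $\alpha_k$ not adjacent to $\alpha_\ell$ and $\beta_k$ not adjacent to $\beta_\ell$ in $C_4$. -}

module Defs where

open import Level using (0ℓ)
open import Data.Nat using (ℕ; _<_; _≤_)
open import Data.Fin using (Fin)
open import Data.Product using (Σ; ∃; ∃-syntax; _×_; _,_)
open import Data.Sum using (_⊎_)
open import Data.Empty using (⊥)
open import Data.List using (List; []; _∷_; length; take; drop)
open import Data.List.NonEmpty using (List⁺; toList; head; last)
open import Data.List.Membership.Propositional using (_∈_)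
open import Data.List.Relation.Unary.Linked using (Linked)
open import Data.List.Relation.Unary.Unique.Propositional using (Unique)
open import Relation.Nullary using (¬_)
open import Relation.Binary.PropositionalEquality using (_≡_; _≢_)
open import Function.Bundles using (_⇔_)

record Graph (n : ℕ) : Set₁ where
  field
    Adj    : Fin n → Fin n → Set
    sym    : ∀ {u v} → Adj u v → Adj v u
    irrefl : ∀ {u} → ¬ Adj u u
open Graph public

VSet : ℕ → Set₁
VSet n = Fin n → Set

Consec : ∀ {n} → List (Fin n) → Fin n → Fin n → Set
Consec []           u v = ⊥
Consec (x ∷ [])     u v = ⊥
Consec (x ∷ y ∷ xs) u v = (u ≡ x × v ≡ y) ⊎ Consec (y ∷ xs) u v

IsPath : ∀ {n} → Graph n → List⁺ (Fin n) → Set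
IsPath G p = Linked (Adj G) (toList p) × Unique (toList p)

record Linkage {n} (G : Graph n) (t : ℕ) : Set where
  field
    path     : Fin t → List⁺ (Fin n)
    isPath   : ∀ i → IsPath G (path i)
    disjoint : ∀ i j v → v ∈ toList (path i) → v ∈ toList (path j) → i ≡ j
open Linkage public

InV : ∀ {n G t} → Linkage {n} G t → Fin n → Set
InV P v = ∃[ i ] v ∈ toList (path P i)

InE : ∀ {n G t} → Linkage {n} G t → Fin n → Fin n → Set
InE P u v = ∃[ i ] (Consec (toList (path P i)) u v ⊎ Consec (toList (path P i)) v u)

IsABLinkage : ∀ {n G t} → VSet n → VSet n → Linkage {n} G t → Set
IsABLinkage α β P =
  (∀ v → α v ⇔ (∃[ i ] v ≡ head (path P i))) ×
  (∀ v → β v ⇔ (∃[ i ] v ≡ last (path P i)))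

SameSubgraph : ∀ {n G t s} → Linkage {n} G t → Linkage {n} G s → Set
SameSubgraph P Q = (∀ v → InV P v ⇔ InV Q v) × (∀ u v → InE P u v ⇔ InE Q u v)

IsRigid : ∀ {n G t} → VSet n → VSet n → Linkage {n} G t → Set
IsRigid {n} {G} α β P =
  IsABLinkage α β P ×
  (∀ s (Q : Linkage G s) → IsABLinkage α β Q → SameSubgraph P Q)

Spanning : ∀ {n G t} → Linkage {n} G t → Set
Spanning P = ∀ v → InV P v

IsChord : ∀ {n G t} → Linkage {n} G t → Fin n → Fin n → Set
IsChord {G = G} P u v =
  Adj G u v × ¬ InE P u v ×
  (∃[ i ] (u ∈ toList (path P i) × v ∈ toList (path P i)))

Chordless : ∀ {n G t} → Linkage {n} G t → Set
Chordless P = ∀ u v → ¬ IsChord P u v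

IsRung : ∀ {n G t} → Linkage {n} G t → Fin n → Fin n → Set
IsRung {G = G} P u v = Adj G u v × ¬ InE P u v × ¬ IsChord P u v

-- (α,β)-linkage minor for p_k, p_ℓ isomorphic to the X-shaped C4.
-- The minor lives on G restricted to V(p_k) ∪ V(p_ℓ).  Since the labelled
-- vertices α_k,β_k,α_ℓ,β_ℓ must be the only vertices of the minor, all path
-- edges of p_k except one (the one after position m) are contracted, giving
-- the segments Ak = take m p_k ∋ α_k and Bk = drop m p_k ∋ β_k
-- (0 < m < |p_k|); likewise Aℓ, Bℓ for p_ℓ with split m'.  Two segments S ≠ T are adjacent in the minor iff
-- some undeleted edge of G joins them.
MinorEdge : ∀ {n G t} → Linkage {n} G t → (Fin n → Fin n → Set) →
            List (Fin n) → List (Fin n) → Set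
MinorEdge {G = G} P D S T =
  ∃[ u ] ∃[ v ] (u ∈ S × v ∈ T × Adj G u v × ¬ D u v × ¬ D v u)

XMinorFor : ∀ {n G t} → Linkage {n} G t → Fin t → Fin t → Set₁
XMinorFor P k ℓ =
  let pk = toList (path P k)
      pl = toList (path P ℓ)
  in Σ ℕ λ m → Σ ℕ λ m' →
     (0 < m) × (m < length pk) × (0 < m') × (m' < length pl) ×
     Σ (Fin _ → Fin _ → Set) λ D →
       (∀ u v → D u v → IsRung P u v) ×
       let Ak = take m pk ; Bk = drop m pk
           Al = take m' pl ; Bl = drop m' pl
       in MinorEdge P D Ak Bk × MinorEdge P D Al Bl ×
          MinorEdge P D Ak Bl × MinorEdge P D Bk Al ×
          ¬ MinorEdge P D Ak Al × ¬ MinorEdge P D Bk Bl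

HasXMinor : ∀ {n G t} → Linkage {n} G t → Set₁
HasXMinor P = Σ _ λ k → Σ _ λ ℓ → (k ≢ ℓ) × XMinorFor P k ℓ

-- A rigid linkage P has no chord and no X: shortcutting a path along a chord, or exchanging the
-- tails of the two paths of an X along its two crossing edges, gives another (α,β)-linkage that
-- uses an edge which is not an edge of P.
--
-- Conversely, let P = {p₀, p₁} be spanning and chordless with no X, let Q be an (α,β)-linkage
-- and let qᵢ be its path starting at αᵢ.  Since p₀, p₁ have no chords, qᵢ runs along pᵢ until it
-- either stops, and then ending in β it is all of pᵢ, or leaves pᵢ along an edge xw.  In the
-- latter case w lies on the other path p, beyond the part of p already used by the other path q
-- of Q; hence q cannot run along p to its end either, and leaves it along an edge yz with z on
-- pᵢ beyond x.  The edges xw and yz form an X.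
module Submission where

open import Defs renaming (sym to Adj-sym)
open import Data.Nat using (ℕ; suc; _<_; z<s; s<s)
open import Data.Fin using (Fin; zero; suc)
open import Data.Fin.Properties using (_≟_)
open import Data.List using (List; []; _∷_; _++_; [_]; take; drop; length)
open import Data.List.Properties using (++-assoc; ∷-injective; ∷ʳ-injective; take++drop≡id)
open import Data.List.NonEmpty
  using (List⁺; _∷_; toList; head; tail; last; _++⁺_; snocView; _∷ʳ′_)
open import Data.List.Membership.Propositional using (_∈_; _∉_)
open import Data.List.Membership.Propositional.Properties using (∈-++⁺ˡ; ∈-++⁺ʳ; ∈-++⁻; ∈-∃++)
open import Data.List.Relation.Unary.Any using (here; there; any?)
open import Data.List.Relation.Unary.All as All using ()
open import Data.List.Relation.Unary.All.Properties using (++⁻ˡ; ++⁻ʳ)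
open import Data.List.Relation.Unary.Linked using (Linked; []; [-]; _∷_)
open import Data.List.Relation.Unary.Unique.Propositional using (Unique; []; _∷_)
open import Data.List.Relation.Unary.Unique.Propositional.Properties
  using (Unique[x∷xs]⇒x∉xs) renaming (++⁺ to Unique-++⁺)
open import Data.List.Relation.Binary.Disjoint.Propositional using (Disjoint)
open import Data.Vec.Functional using (Vector; updateAt)
open import Data.Vec.Functional.Properties using (updateAt-updates; updateAt-minimal)
open import Data.Product using (∃; ∃₂; _×_; _,_; proj₁; proj₂; map₁)
open import Data.Sum using (_⊎_; inj₁; inj₂; swap; reduce)
open import Data.Empty using (⊥; ⊥-elim)
open import Function.Base using (_∘_)
open import Function.Bundles using (Equivalence; mk⇔)
open import Relation.Nullary using (¬_; Dec; yes; no)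
open import Relation.Nullary.Decidable using (_×-dec_; _⊎-dec_)
open import Relation.Binary.PropositionalEquality
  using (_≡_; _≢_; refl; sym; trans; cong; cong₂; subst)

-- Lists

module _ {A : Set} where

  split-unique : ∀ xs xs′ {y : A} {ys ys′} → Unique (xs ++ y ∷ ys) →
                 xs ++ y ∷ ys ≡ xs′ ++ y ∷ ys′ → xs ≡ xs′ × ys ≡ ys′
  split-unique []       []         _       refl = refl , refl
  split-unique []       (_ ∷ xs′)  u       refl =
    ⊥-elim (Unique[x∷xs]⇒x∉xs u (∈-++⁺ʳ xs′ (here refl)))
  split-unique (_ ∷ xs) []         u       refl =
    ⊥-elim (Unique[x∷xs]⇒x∉xs u (∈-++⁺ʳ xs (here refl)))
  split-unique (x ∷ xs) (_ ∷ xs′)  (_ ∷ u) eq with refl , eq′ ← ∷-injective eq =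
    map₁ (cong (x ∷_)) (split-unique xs xs′ u eq′)

  Unique-++⁻ : ∀ (xs : List A) {ys} → Unique (xs ++ ys) → Unique xs × Unique ys × Disjoint xs ys
  Unique-++⁻ []       u        = [] , u , λ ()
  Unique-++⁻ (x ∷ xs) (x∉ ∷ u) with Unique-++⁻ xs u
  ... | uxs , uys , xs#ys = ++⁻ˡ xs x∉ ∷ uxs , uys , λ where
    (here refl  , v∈ys) → All.lookup (++⁻ʳ xs x∉) v∈ys refl
    (there v∈xs , v∈ys) → xs#ys (v∈xs , v∈ys)

  Unique-split⁻ : ∀ (xs : List A) {x ys} → Unique (xs ++ x ∷ ys) →
                  Unique (xs ++ [ x ]) × Disjoint (xs ++ [ x ]) ys
  Unique-split⁻ xs {x} {ys} u
    with uxs , _ , xs#ys ← Unique-++⁻ (xs ++ [ x ]) (subst Unique (sym (++-assoc xs [ x ] ys)) u) =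
    uxs , xs#ys

  split-∈ : ∀ {xs} pre {x : A} {post} → xs ≡ pre ++ x ∷ post → x ∈ xs
  split-∈ pre refl = ∈-++⁺ʳ pre (here refl)

  ∈-front : ∀ pre {x : A} {post v} → v ∈ pre ++ [ x ] → v ∈ pre ++ x ∷ post
  ∈-front pre v∈ with ∈-++⁻ pre v∈
  ... | inj₁ v∈pre       = ∈-++⁺ˡ v∈pre
  ... | inj₂ (here refl) = ∈-++⁺ʳ pre (here refl)

  ∈-split⁻ : ∀ (xs : List A) {x ys zs v} → v ∈ xs ++ x ∷ ys → v ∈ xs ++ x ∷ zs ⊎ v ∈ ys
  ∈-split⁻ xs v∈ with ∈-++⁻ xs v∈
  ... | inj₁ v∈xs         = inj₁ (∈-++⁺ˡ v∈xs)
  ... | inj₂ (here refl)  = inj₁ (∈-++⁺ʳ xs (here refl))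
  ... | inj₂ (there v∈ys) = inj₂ v∈ys

  module _ {R : A → A → Set} where

    Linked-++⁻ʳ : ∀ xs {ys} → Linked R (xs ++ ys) → Linked R ys
    Linked-++⁻ʳ []           l       = l
    Linked-++⁻ʳ (_ ∷ [])     [-]     = []
    Linked-++⁻ʳ (_ ∷ [])     (_ ∷ l) = l
    Linked-++⁻ʳ (_ ∷ y ∷ xs) (_ ∷ l) = Linked-++⁻ʳ (y ∷ xs) l

    Linked-splice : ∀ xs {x ys y zs} → Linked R (xs ++ x ∷ ys) → R x y → Linked R (y ∷ zs) →
                    Linked R (xs ++ x ∷ y ∷ zs)
    Linked-splice []           _         r l = r ∷ l
    Linked-splice (_ ∷ [])     (r′ ∷ _)  r l = r′ ∷ r ∷ l
    Linked-splice (_ ∷ _ ∷ xs) (r′ ∷ l′) r l = r′ ∷ Linked-splice (_ ∷ xs) l′ r l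

    Linked-step : ∀ xs {x y ys} → Linked R (xs ++ x ∷ y ∷ ys) → R x y
    Linked-step xs l with r ∷ _ ← Linked-++⁻ʳ xs l = r

  Unique-splice : ∀ xs {x ys y zs} → Unique (xs ++ x ∷ ys) → Unique (y ∷ zs) →
                  Disjoint (xs ++ [ x ]) (y ∷ zs) → Unique (xs ++ x ∷ y ∷ zs)
  Unique-splice xs {x} {y = y} {zs} u u′ disj =
    subst Unique (++-assoc xs [ x ] (y ∷ zs)) (Unique-++⁺ (proj₁ (Unique-split⁻ xs u)) u′ disj)

  data Before (xs : List A) (x y : A) : Set where
    before : ∀ pre {post} → xs ≡ pre ++ x ∷ post → y ∈ post → Before xs x y

  ∈-++-Before : ∀ {xs ys : List A} {x y} → x ∈ xs → y ∈ ys → Before (xs ++ ys) x y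
  ∈-++-Before {ys = ys} x∈ y∈ with pre , post , refl ← ∈-∃++ x∈ =
    before pre (++-assoc pre (_ ∷ post) ys) (∈-++⁺ʳ post y∈)

  ∈-Before : ∀ {xs : List A} {x y} → x ∈ xs → y ∈ xs → x ≢ y → Before xs x y ⊎ Before xs y x
  ∈-Before x∈ y∈ x≢y with pre , post , refl ← ∈-∃++ x∈ | ∈-++⁻ pre y∈
  ... | inj₂ (here y≡x)   = ⊥-elim (x≢y (sym y≡x))
  ... | inj₂ (there y∈ys) = inj₁ (before pre refl y∈ys)
  ... | inj₁ y∈pre        = inj₂ (∈-++-Before y∈pre (here refl))

  Before⇒split : ∀ {xs : List A} {x y} → Before xs x y →
                 ∃₂ λ pre mid → ∃ λ post → xs ≡ pre ++ x ∷ mid ++ y ∷ post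
  Before⇒split (before pre refl y∈) with mid , post , refl ← ∈-∃++ y∈ = pre , mid , post , refl

  take-split : ∀ xs {x : A} ys → take (suc (length xs)) (xs ++ x ∷ ys) ≡ xs ++ [ x ]
  take-split []       ys = refl
  take-split (x ∷ xs) ys = cong (x ∷_) (take-split xs ys)

  drop-split : ∀ xs {x : A} ys → drop (suc (length xs)) (xs ++ x ∷ ys) ≡ ys
  drop-split []       ys = refl
  drop-split (_ ∷ xs) ys = drop-split xs ys

  split<length : ∀ {zs} xs {x y : A} {ys} → zs ≡ xs ++ x ∷ ys → y ∈ ys →
                 suc (length xs) < length zs
  split<length []       refl (here _)  = s<s z<s
  split<length []       refl (there _) = s<s z<s
  split<length (_ ∷ xs) refl y∈        = s<s (split<length xs refl y∈)

  ∈-take⁻ : ∀ m {xs : List A} {v} → v ∈ take m xs → v ∈ xs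
  ∈-take⁻ m {xs} v∈ = subst (_ ∈_) (take++drop≡id m xs) (∈-++⁺ˡ v∈)

  ∈-drop⁻ : ∀ m {xs : List A} {v} → v ∈ drop m xs → v ∈ xs
  ∈-drop⁻ m {xs} v∈ = subst (_ ∈_) (take++drop≡id m xs) (∈-++⁺ʳ (take m xs) v∈)

  take-drop-disjoint : ∀ m {xs : List A} → Unique xs → Disjoint (take m xs) (drop m xs)
  take-drop-disjoint m {xs} u =
    proj₂ (proj₂ (Unique-++⁻ (take m xs) (subst Unique (sym (take++drop≡id m xs)) u)))

  toList-++⁺ : ∀ xs (L : List⁺ A) → toList (xs ++⁺ L) ≡ xs ++ toList L
  toList-++⁺ []       (_ ∷ _) = refl
  toList-++⁺ (x ∷ xs) L       = cong (x ∷_) (toList-++⁺ xs L)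

  head-common : ∀ {L M : List⁺ A} xs {x ys zs} →
                toList L ≡ xs ++ x ∷ ys → toList M ≡ xs ++ x ∷ zs → head L ≡ head M
  head-common {_ ∷ _} {_ ∷ _} []      refl refl = refl
  head-common {_ ∷ _} {_ ∷ _} (_ ∷ _) refl refl = refl

  toList-last : ∀ (L : List⁺ A) → ∃ λ xs → toList L ≡ xs ++ [ last L ]
  toList-last L with snocView L
  ... | xs ∷ʳ′ x = xs , toList-∷ʳ xs
    where
      toList-∷ʳ : ∀ xs → toList (xs Data.List.NonEmpty.∷ʳ x) ≡ xs ++ [ x ]
      toList-∷ʳ []      = refl
      toList-∷ʳ (_ ∷ _) = refl

  last-≡ : ∀ (L : List⁺ A) xs {x} → toList L ≡ xs ++ [ x ] → last L ≡ x
  last-≡ L xs eq with ys , eq′ ← toList-last L =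
    sym (proj₂ (∷ʳ-injective xs ys (trans (sym eq) eq′)))

  last-suffix : ∀ (L : List⁺ A) xs {z zs} → toList L ≡ xs ++ z ∷ zs → last L ≡ last (z ∷ zs)
  last-suffix L xs {z} {zs} eq with ys , eq′ ← toList-last (z ∷ zs) =
    last-≡ L (xs ++ ys) (trans eq (trans (cong (xs ++_) eq′) (sym (++-assoc xs ys _))))

  last∈ : ∀ (L : List⁺ A) → last L ∈ toList L
  last∈ L with xs , eq ← toList-last L = subst (last L ∈_) (sym eq) (∈-++⁺ʳ xs (here refl))

  head∈ : ∀ (L : List⁺ A) → head L ∈ toList L
  head∈ (_ ∷ _) = here refl

module _ {n : ℕ} where

  consec-split : ∀ (xs : List (Fin n)) {u v} → Consec xs u v →
                 ∃₂ λ pre post → xs ≡ pre ++ u ∷ v ∷ post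
  consec-split (_ ∷ _ ∷ xs) (inj₁ (refl , refl)) = [] , xs , refl
  consec-split (x ∷ y ∷ xs) (inj₂ c) with pre , post , eq ← consec-split (y ∷ xs) c =
    x ∷ pre , post , cong (x ∷_) eq

  consec-∈ : ∀ {xs : List (Fin n)} {u v} → Consec xs u v → u ∈ xs × v ∈ xs
  consec-∈ {xs} c with pre , _ , eq ← consec-split xs c =
    split-∈ pre eq , split-∈ (pre ++ [ _ ]) (trans eq (sym (++-assoc pre [ _ ] _)))

  splice-consec : ∀ pre {u v : Fin n} {post} → Consec (pre ++ u ∷ v ∷ post) u v
  splice-consec []            = inj₁ (refl , refl)
  splice-consec (_ ∷ [])      = inj₂ (inj₁ (refl , refl))
  splice-consec (_ ∷ y ∷ pre) = inj₂ (splice-consec (y ∷ pre))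

  consec? : ∀ (xs : List (Fin n)) u v → Dec (Consec xs u v)
  consec? []           u v = no λ ()
  consec? (_ ∷ [])     u v = no λ ()
  consec? (x ∷ y ∷ xs) u v = ((u ≟ x) ×-dec (v ≟ y)) ⊎-dec consec? (y ∷ xs) u v

updateAt-cases : ∀ {A : Set} {t} (xs : Vector A t) i f j →
                 (j ≡ i × updateAt xs i f j ≡ f (xs i)) ⊎ (j ≢ i × updateAt xs i f j ≡ xs j)
updateAt-cases xs i f j with j ≟ i
... | yes refl = inj₁ (refl , updateAt-updates i xs)
... | no j≢i   = inj₂ (j≢i , updateAt-minimal j i xs j≢i)

-- Paths of a linkage

verts : ∀ {n} {G : Graph n} {t} → Linkage G t → Fin t → List (Fin n)
verts P i = toList (path P i)

data Follow {n} (G : Graph n) (p q : List (Fin n)) : Set where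
  stops   : ∀ pre x {post} → p ≡ pre ++ x ∷ post → q ≡ pre ++ [ x ] → Follow G p q
  departs : ∀ pre x {post} w {rest} → p ≡ pre ++ x ∷ post → q ≡ pre ++ x ∷ w ∷ rest →
            Adj G x w → w ∉ p → Follow G p q

module _ {n} {G : Graph n} {t} (P : Linkage G t) where

  path-linked : ∀ {i xs} → verts P i ≡ xs → Linked (Adj G) xs
  path-linked {i} eq = subst (Linked (Adj G)) eq (proj₁ (isPath P i))

  path-unique : ∀ {i xs} → verts P i ≡ xs → Unique xs
  path-unique {i} eq = subst Unique eq (proj₂ (isPath P i))

  InE-sym : ∀ {u v} → InE P u v → InE P v u
  InE-sym (i , inj₁ c) = i , inj₂ c
  InE-sym (i , inj₂ c) = i , inj₁ c

  InE⇒same-path : ∀ {u v} → InE P u v → ∃ λ i → u ∈ verts P i × v ∈ verts P i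
  InE⇒same-path (i , inj₁ c) = i , consec-∈ c
  InE⇒same-path (i , inj₂ c) = i , proj₂ (consec-∈ c) , proj₁ (consec-∈ c)

  separated : ∀ {k l u v} → k ≢ l → u ∈ verts P k → v ∈ verts P l →
              ¬ (∃ λ i → u ∈ verts P i × v ∈ verts P i)
  separated {k} {l} k≢l u∈ v∈ (i , u∈′ , v∈′) =
    k≢l (trans (disjoint P k i _ u∈ u∈′) (disjoint P i l _ v∈′ v∈))

  separated-rung : ∀ {k l u v} → k ≢ l → u ∈ verts P k → v ∈ verts P l → Adj G u v →
                   IsRung P u v
  separated-rung k≢l u∈ v∈ a = a , sep ∘ InE⇒same-path , λ (_ , _ , same) → sep same
    where sep = separated k≢l u∈ v∈

  head-injective : ∀ {i j} → head (path P i) ≡ head (path P j) → i ≡ j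
  head-injective {i} {j} eq =
    disjoint P i j _ (head∈ (path P i)) (subst (_∈ verts P j) (sym eq) (head∈ (path P j)))

  module _ (chordless : Chordless P) where

    chordless-consec : ∀ {i u v} → Adj G u v → u ∈ verts P i → v ∈ verts P i →
                       Consec (verts P i) u v ⊎ Consec (verts P i) v u
    chordless-consec {i} {u} {v} a u∈ v∈ with consec? (verts P i) u v | consec? (verts P i) v u
    ... | yes c  | _      = inj₁ c
    ... | no _   | yes c  = inj₂ c
    ... | no ¬uv | no ¬vu = ⊥-elim (chordless u v (a , ¬InE , i , u∈ , v∈))
      where
        ¬InE : ¬ InE P u v
        ¬InE (j , inj₁ c) with refl ← disjoint P i j u u∈ (proj₁ (consec-∈ c)) = ¬uv c
        ¬InE (j , inj₂ c) with refl ← disjoint P i j u u∈ (proj₂ (consec-∈ c)) = ¬vu c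

    chordless-neighbour : ∀ {i} pre {y post w} → verts P i ≡ pre ++ y ∷ post → Adj G y w →
                          w ∈ verts P i → (∃ λ r → post ≡ w ∷ r) ⊎ w ∈ pre
    chordless-neighbour pre eq a w∈ with chordless-consec a (split-∈ pre eq) w∈
    ... | inj₁ c with pre′ , post′ , eq′ ← consec-split _ c =
      inj₁ (post′ , proj₂ (split-unique pre pre′ (path-unique eq) (trans (sym eq) eq′)))
    ... | inj₂ c with pre′ , post′ , eq′ ← consec-split _ c =
      inj₂ (subst (_ ∈_) (sym pre≡) (∈-++⁺ʳ pre′ (here refl)))
      where
        pre≡ = proj₁ (split-unique pre (pre′ ++ [ _ ]) (path-unique eq)
                        (trans (sym eq) (trans eq′ (sym (++-assoc pre′ [ _ ] _)))))

    follow-from : ∀ {i} pre x {post} rest {q} → verts P i ≡ pre ++ x ∷ post →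
                  q ≡ pre ++ x ∷ rest → Linked (Adj G) q → Unique q → Follow G (verts P i) q
    follow-from pre x []         ep eq _  _  = stops pre x ep eq
    follow-from {i} pre x (w ∷ rest) ep eq lq uq = step (any? (w ≟_) (verts P i))
      where
        a : Adj G x w
        a = Linked-step pre (subst (Linked (Adj G)) eq lq)
        step : Dec (w ∈ verts P i) → Follow G (verts P i) _
        step (no w∉) = departs pre x w ep eq a w∉
        step (yes w∈) with chordless-neighbour pre ep a w∈
        ... | inj₁ (_ , refl) =
          follow-from (pre ++ [ x ]) w rest (trans ep (sym (++-assoc pre [ x ] _)))
                      (trans eq (sym (++-assoc pre [ x ] _))) lq uq
        ... | inj₂ w∈pre =
          ⊥-elim (proj₂ (proj₂ (Unique-++⁻ pre (subst Unique eq uq))) (w∈pre , there (here refl)))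

    follow : ∀ {i} (q : List⁺ (Fin n)) → IsPath G q → head q ≡ head (path P i) →
             Follow G (verts P i) (toList q)
    follow {i} (_ ∷ xs) (lq , uq) refl = follow-from [] _ xs (toList-cons (path P i)) refl lq uq
      where
        toList-cons : ∀ (L : List⁺ (Fin n)) → toList L ≡ head L ∷ tail L
        toList-cons (_ ∷ _) = refl

-- An X minor before contraction: cutting p_k after x and p_l after y, the edges xw and yz join
-- each front to the back of the other path.
data Crossing {n} {G : Graph n} {t} (P : Linkage G t) (k l : Fin t) : Set where
  crossing : ∀ {x y z w} → Before (verts P k) x z → Before (verts P l) y w →
             Adj G x w → Adj G y z → Crossing P k l

-- Rerouting

module _ {n} {G : Graph n} {t} (P : Linkage G t) where

  split-suffix : ∀ {i} pre {x : Fin n} mid {y post} → verts P i ≡ pre ++ x ∷ mid ++ y ∷ post →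
                 verts P i ≡ (pre ++ x ∷ mid) ++ y ∷ post
  split-suffix pre {x} mid {y} {post} eq = trans eq (sym (++-assoc pre (x ∷ mid) (y ∷ post)))

  split-disjoint : ∀ {i} pre {x : Fin n} mid {y post} → verts P i ≡ pre ++ x ∷ mid ++ y ∷ post →
                   Disjoint (pre ++ [ x ]) (y ∷ post)
  split-disjoint pre mid eq (v∈front , v∈back) =
    proj₂ (Unique-split⁻ pre (path-unique P eq)) (v∈front , ∈-++⁺ʳ mid v∈back)

  separated-split : ∀ {k l} → k ≢ l → ∀ pre {x : Fin n} {post pre′ y rest} →
                    verts P k ≡ pre ++ x ∷ post → verts P l ≡ pre′ ++ y ∷ rest →
                    Disjoint (pre ++ [ x ]) (y ∷ rest)
  separated-split {k} {l} k≢l pre ek el (v∈front , v∈back) =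
    k≢l (disjoint P k l _ (subst (_ ∈_) (sym ek) (∈-front pre v∈front))
                          (subst (_ ∈_) (sym el) (∈-++⁺ʳ _ v∈back)))

  module Splice {k l : Fin t} pre {x : Fin n} {post} pre′ {y : Fin n} {rest}
                (ek : verts P k ≡ pre ++ x ∷ post) (el : verts P l ≡ pre′ ++ y ∷ rest)
                (a : Adj G x y) (front#back : Disjoint (pre ++ [ x ]) (y ∷ rest)) where

    spliced : List⁺ (Fin n)
    spliced = pre ++⁺ (x ∷ y ∷ rest)

    toList-spliced : toList spliced ≡ pre ++ x ∷ y ∷ rest
    toList-spliced = toList-++⁺ pre (x ∷ y ∷ rest)

    spliced-isPath : IsPath G spliced
    spliced-isPath =
      subst (Linked (Adj G)) (sym toList-spliced)
        (Linked-splice pre (path-linked P ek) a (Linked-++⁻ʳ pre′ (path-linked P el))) ,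
      subst Unique (sym toList-spliced)
        (Unique-splice pre (path-unique P ek) (proj₁ (proj₂ (Unique-++⁻ pre′ (path-unique P el))))
                       front#back)

    spliced-head : head spliced ≡ head (path P k)
    spliced-head = head-common pre toList-spliced ek

    spliced-last : last spliced ≡ last (path P l)
    spliced-last =
      trans (last-suffix spliced (pre ++ [ x ]) (trans toList-spliced (sym (++-assoc pre [ x ] _))))
            (sym (last-suffix (path P l) pre′ el))

    spliced-consec : Consec (toList spliced) x y
    spliced-consec = subst (λ xs → Consec xs x y) (sym toList-spliced) (splice-consec pre)

    ∈-spliced⁻ : ∀ {v} → v ∈ toList spliced → v ∈ pre ++ [ x ] ⊎ v ∈ y ∷ rest
    ∈-spliced⁻ v∈ = ∈-split⁻ pre (subst (_ ∈_) toList-spliced v∈)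

    front⊆ : ∀ {v} → v ∈ pre ++ [ x ] → v ∈ verts P k
    front⊆ v∈ = subst (_ ∈_) (sym ek) (∈-front pre v∈)

    back⊆ : ∀ {v} → v ∈ y ∷ rest → v ∈ verts P l
    back⊆ v∈ = subst (_ ∈_) (sym el) (∈-++⁺ʳ pre′ v∈)

    spliced⊆ : ∀ {v} → v ∈ toList spliced → v ∈ verts P k ⊎ v ∈ verts P l
    spliced⊆ v∈ with ∈-spliced⁻ v∈
    ... | inj₁ v∈front = inj₁ (front⊆ v∈front)
    ... | inj₂ v∈back  = inj₂ (back⊆ v∈back)

  IsABLinkage-resp-ends : ∀ {α β} (Q : Linkage G t) →
    (∀ j → head (path Q j) ≡ head (path P j)) →
    (∀ j → ∃ λ i → last (path Q j) ≡ last (path P i)) →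
    (∀ i → ∃ λ j → last (path Q j) ≡ last (path P i)) →
    IsABLinkage α β P → IsABLinkage α β Q
  IsABLinkage-resp-ends Q heads lasts→ lasts← (αP , βP) =
    (λ v → mk⇔ (λ αv → let i , e = to (αP v) αv in i , trans e (sym (heads i)))
               (λ (j , e) → from (αP v) (j , trans e (heads j)))) ,
    (λ v → mk⇔ (λ βv → let i , e = to (βP v) βv ; j , e′ = lasts← i in j , trans e (sym e′))
               (λ (j , e) → let i , e′ = lasts→ j in from (βP v) (i , trans e e′)))
    where open Equivalence

  module Replace (i : Fin t) (N : List⁺ (Fin n)) (N-path : IsPath G N)
                 (N⊆ : ∀ {v} → v ∈ toList N → v ∈ verts P i) where

    paths : Fin t → List⁺ (Fin n)
    paths = updateAt (path P) i (λ _ → N)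

    paths-isPath : ∀ j → IsPath G (paths j)
    paths-isPath j with updateAt-cases (path P) i (λ _ → N) j
    ... | inj₁ (refl , eq) = subst (IsPath G) (sym eq) N-path
    ... | inj₂ (_ , eq)    = subst (IsPath G) (sym eq) (isPath P j)

    paths⊆ : ∀ j {v} → v ∈ toList (paths j) → v ∈ verts P j
    paths⊆ j {v} with updateAt-cases (path P) i (λ _ → N) j
    ... | inj₁ (refl , eq) = N⊆ ∘ subst (λ L → v ∈ toList L) eq
    ... | inj₂ (_ , eq)    = subst (λ L → v ∈ toList L) eq

    linkage : Linkage G t
    linkage = record
      { path     = paths
      ; isPath   = paths-isPath
      ; disjoint = λ a b v va vb → disjoint P a b v (paths⊆ a va) (paths⊆ b vb)
      }

    linkage-IsAB : ∀ {α β} → head N ≡ head (path P i) → last N ≡ last (path P i) →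
                   IsABLinkage α β P → IsABLinkage α β linkage
    linkage-IsAB headN lastN =
      IsABLinkage-resp-ends linkage heads (λ j → j , lasts j) (λ j → j , lasts j)
      where
        heads : ∀ j → head (paths j) ≡ head (path P j)
        heads j with updateAt-cases (path P) i (λ _ → N) j
        ... | inj₁ (refl , eq) = trans (cong head eq) headN
        ... | inj₂ (_ , eq)    = cong head eq
        lasts : ∀ j → last (paths j) ≡ last (path P j)
        lasts j with updateAt-cases (path P) i (λ _ → N) j
        ... | inj₁ (refl , eq) = trans (cong last eq) lastN
        ... | inj₂ (_ , eq)    = cong last eq

    linkage-InE : ∀ {u v} → Consec (toList N) u v → InE linkage u v
    linkage-InE {u} {v} c =
      i , inj₁ (subst (λ L → Consec (toList L) u v) (sym (updateAt-updates i (path P))) c)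

  module Swap {k l : Fin t} (k≢l : k ≢ l) (Nk Nl : List⁺ (Fin n))
              (Nk-path : IsPath G Nk) (Nl-path : IsPath G Nl)
              (Nk#Nl : Disjoint (toList Nk) (toList Nl))
              (Nk⊆ : ∀ {v} → v ∈ toList Nk → v ∈ verts P k ⊎ v ∈ verts P l)
              (Nl⊆ : ∀ {v} → v ∈ toList Nl → v ∈ verts P k ⊎ v ∈ verts P l) where

    paths : Fin t → List⁺ (Fin n)
    paths = updateAt (updateAt (path P) k (λ _ → Nk)) l (λ _ → Nl)

    data View (j : Fin t) : Set where
      at-k      : j ≡ k → paths j ≡ Nk → View j
      at-l      : j ≡ l → paths j ≡ Nl → View j
      elsewhere : j ≢ k → j ≢ l → paths j ≡ path P j → View j

    view : ∀ j → View j
    view j with updateAt-cases (updateAt (path P) k (λ _ → Nk)) l (λ _ → Nl) j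
    ... | inj₁ (j≡l , eq) = at-l j≡l eq
    ... | inj₂ (j≢l , eq) with updateAt-cases (path P) k (λ _ → Nk) j
    ...   | inj₁ (j≡k , eq′) = at-k j≡k (trans eq eq′)
    ...   | inj₂ (j≢k , eq′) = elsewhere j≢k j≢l (trans eq eq′)

    paths-k : paths k ≡ Nk
    paths-k = trans (updateAt-minimal k l _ k≢l) (updateAt-updates k (path P))

    paths-l : paths l ≡ Nl
    paths-l = updateAt-updates l _

    paths-isPath : ∀ j → IsPath G (paths j)
    paths-isPath j with view j
    ... | at-k _ eq        = subst (IsPath G) (sym eq) Nk-path
    ... | at-l _ eq        = subst (IsPath G) (sym eq) Nl-path
    ... | elsewhere _ _ eq = subst (IsPath G) (sym eq) (isPath P j)

    private
      along : ∀ {j L v} → paths j ≡ L → v ∈ toList (paths j) → v ∈ toList L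
      along {v = v} eq = subst (λ L → v ∈ toList L) eq

      outside : ∀ {j v} → j ≢ k → j ≢ l → v ∈ verts P k ⊎ v ∈ verts P l → v ∈ verts P j → ⊥
      outside j≢k _   (inj₁ v∈k) v∈j = j≢k (disjoint P _ k _ v∈j v∈k)
      outside _   j≢l (inj₂ v∈l) v∈j = j≢l (disjoint P _ l _ v∈j v∈l)

    paths-disjoint : ∀ a b v → v ∈ toList (paths a) → v ∈ toList (paths b) → a ≡ b
    paths-disjoint a b v va vb with view a | view b
    ... | at-k refl _  | at-k refl _  = refl
    ... | at-l refl _  | at-l refl _  = refl
    ... | at-k refl ea | at-l refl eb = ⊥-elim (Nk#Nl (along ea va , along eb vb))
    ... | at-l refl ea | at-k refl eb = ⊥-elim (Nk#Nl (along eb vb , along ea va))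
    ... | at-k refl ea | elsewhere b≢k b≢l eb =
      ⊥-elim (outside b≢k b≢l (Nk⊆ (along ea va)) (along eb vb))
    ... | at-l refl ea | elsewhere b≢k b≢l eb =
      ⊥-elim (outside b≢k b≢l (Nl⊆ (along ea va)) (along eb vb))
    ... | elsewhere a≢k a≢l ea | at-k refl eb =
      ⊥-elim (outside a≢k a≢l (Nk⊆ (along eb vb)) (along ea va))
    ... | elsewhere a≢k a≢l ea | at-l refl eb =
      ⊥-elim (outside a≢k a≢l (Nl⊆ (along eb vb)) (along ea va))
    ... | elsewhere _ _ ea | elsewhere _ _ eb = disjoint P a b v (along ea va) (along eb vb)

    linkage : Linkage G t
    linkage = record { path = paths ; isPath = paths-isPath ; disjoint = paths-disjoint }

    linkage-IsAB : ∀ {α β} → head Nk ≡ head (path P k) → head Nl ≡ head (path P l) →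
                   last Nk ≡ last (path P l) → last Nl ≡ last (path P k) →
                   IsABLinkage α β P → IsABLinkage α β linkage
    linkage-IsAB headk headl lastk lastl = IsABLinkage-resp-ends linkage heads lasts→ lasts←
      where
        heads : ∀ j → head (paths j) ≡ head (path P j)
        heads j with view j
        ... | at-k refl eq     = trans (cong head eq) headk
        ... | at-l refl eq     = trans (cong head eq) headl
        ... | elsewhere _ _ eq = cong head eq
        lasts→ : ∀ j → ∃ λ i → last (paths j) ≡ last (path P i)
        lasts→ j with view j
        ... | at-k _ eq        = l , trans (cong last eq) lastk
        ... | at-l _ eq        = k , trans (cong last eq) lastl
        ... | elsewhere _ _ eq = j , cong last eq
        lasts← : ∀ i → ∃ λ j → last (paths j) ≡ last (path P i)
        lasts← i with view i
        ... | at-k refl _      = l , trans (cong last paths-l) lastl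
        ... | at-l refl _      = k , trans (cong last paths-k) lastk
        ... | elsewhere _ _ eq = i , cong last eq

    linkage-InE : ∀ {u v} → Consec (toList Nk) u v → InE linkage u v
    linkage-InE {u} {v} c = k , inj₁ (subst (λ L → Consec (toList L) u v) (sym paths-k) c)

  module _ {α β} (rigid : IsRigid α β P) where

    private
      rigid-InE : ∀ {s} (Q : Linkage G s) → IsABLinkage α β Q → ∀ {u v} → InE Q u v → InE P u v
      rigid-InE {s} Q abQ {u} {v} = Equivalence.from (proj₂ (proj₂ rigid s Q abQ) u v)

    rigid-shortcut : ∀ {i x y} → Before (verts P i) x y → Adj G x y → InE P x y
    rigid-shortcut {i} {x} x<y a with pre , mid , post , eq ← Before⇒split x<y =
      rigid-InE R.linkage (R.linkage-IsAB S.spliced-head S.spliced-last (proj₁ rigid))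
                (R.linkage-InE S.spliced-consec)
      where
        module S = Splice pre (pre ++ x ∷ mid) eq (split-suffix pre mid eq) a
                          (split-disjoint pre mid eq)
        module R = Replace i S.spliced S.spliced-isPath (reduce ∘ S.spliced⊆)

    rigid⇒chordless : Chordless P
    rigid⇒chordless u v (a , ¬InE , i , u∈ , v∈) with ∈-Before u∈ v∈ (λ { refl → irrefl G a })
    ... | inj₁ u<v = ¬InE (rigid-shortcut u<v a)
    ... | inj₂ v<u = ¬InE (InE-sym P (rigid-shortcut v<u (Adj-sym G a)))

    rigid⇒¬crossing : ∀ {k l} → k ≢ l → ¬ Crossing P k l
    rigid⇒¬crossing {k} {l} k≢l (crossing {x} {y} x<z y<w axw ayz)
      with A , M , B , ek ← Before⇒split x<z | C , M′ , D , el ← Before⇒split y<w =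
      separated P k≢l (K.front⊆ (∈-++⁺ʳ A (here refl))) (K.back⊆ (here refl))
        (InE⇒same-path P (rigid-InE X.linkage
          (X.linkage-IsAB K.spliced-head L.spliced-head K.spliced-last L.spliced-last (proj₁ rigid))
          (X.linkage-InE K.spliced-consec)))
      where
        ek′ = split-suffix A M ek
        el′ = split-suffix C M′ el
        module K = Splice A (C ++ y ∷ M′) ek el′ axw (separated-split k≢l A ek el′)
        module L = Splice C (A ++ x ∷ M) el ek′ ayz (separated-split (k≢l ∘ sym) C el ek′)
        sep : ∀ {v} → v ∈ verts P k → v ∈ verts P l → ⊥
        sep v∈k v∈l = k≢l (disjoint P k l _ v∈k v∈l)
        Nk#Nl : Disjoint (toList K.spliced) (toList L.spliced)
        Nk#Nl (v∈k , v∈l) with K.∈-spliced⁻ v∈k | L.∈-spliced⁻ v∈l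
        ... | inj₁ front₁ | inj₁ front₂ = sep (K.front⊆ front₁) (L.front⊆ front₂)
        ... | inj₁ front₁ | inj₂ back₂  = split-disjoint A M ek (front₁ , back₂)
        ... | inj₂ back₁  | inj₁ front₂ = split-disjoint C M′ el (front₂ , back₁)
        ... | inj₂ back₁  | inj₂ back₂  = sep (L.back⊆ back₂) (K.back⊆ back₁)
        module X = Swap k≢l K.spliced L.spliced K.spliced-isPath L.spliced-isPath Nk#Nl
                        K.spliced⊆ (swap ∘ L.spliced⊆)

-- X minors

module Contraction {n} {G : Graph n} {t} (P : Linkage G t) {k l : Fin t} (k≢l : k ≢ l)
                   (m m′ : ℕ) where

  data Side : Set where
    K L : Side

  data Half : Set where
    front back : Half

  index : Side → Fin t
  index K = k
  index L = l

  cut : Side → ℕ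
  cut K = m
  cut L = m′

  segment : Side → Half → List (Fin n)
  segment s front = take (cut s) (verts P (index s))
  segment s back  = drop (cut s) (verts P (index s))

  segment⊆ : ∀ s h {v} → v ∈ segment s h → v ∈ verts P (index s)
  segment⊆ s front = ∈-take⁻ (cut s)
  segment⊆ s back  = ∈-drop⁻ (cut s)

  index-injective : ∀ {s s′} → index s ≡ index s′ → s ≡ s′
  index-injective {K} {K} _  = refl
  index-injective {K} {L} eq = ⊥-elim (k≢l eq)
  index-injective {L} {K} eq = ⊥-elim (k≢l (sym eq))
  index-injective {L} {L} _  = refl

  segment-unique : ∀ s h s′ h′ {v} → v ∈ segment s h → v ∈ segment s′ h′ → s ≡ s′ × h ≡ h′
  segment-unique s h s′ h′ v∈ v∈′
    with refl ← index-injective (disjoint P _ _ _ (segment⊆ s h v∈) (segment⊆ s′ h′ v∈′)) =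
    refl , halves h h′ v∈ v∈′
    where
      take#drop = take-drop-disjoint (cut s) (proj₂ (isPath P (index s)))
      halves : ∀ h h′ → _ ∈ segment s h → _ ∈ segment s h′ → h ≡ h′
      halves front front _   _   = refl
      halves back  back  _   _   = refl
      halves front back  v∈f v∈b = ⊥-elim (take#drop (v∈f , v∈b))
      halves back  front v∈b v∈f = ⊥-elim (take#drop (v∈f , v∈b))

  Deleted : Fin n → Fin n → Set
  Deleted u v = Adj G u v ×
    ∃ λ h → (u ∈ segment K h × v ∈ segment L h) ⊎ (u ∈ segment L h × v ∈ segment K h)

  Deleted-rung : ∀ u v → Deleted u v → IsRung P u v
  Deleted-rung u v (a , h , inj₁ (u∈ , v∈)) =
    separated-rung P k≢l (segment⊆ K h u∈) (segment⊆ L h v∈) a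
  Deleted-rung u v (a , h , inj₂ (u∈ , v∈)) =
    separated-rung P (k≢l ∘ sym) (segment⊆ L h u∈) (segment⊆ K h v∈) a

  kept : ∀ s h s′ h′ {u v} → u ∈ segment s h → v ∈ segment s′ h′ → h ≢ h′ → ¬ Deleted u v
  kept s h s′ h′ u∈ v∈ h≢h′ (_ , h″ , inj₁ (u∈″ , v∈″)) =
    h≢h′ (trans (proj₂ (segment-unique s h K h″ u∈ u∈″))
                (sym (proj₂ (segment-unique s′ h′ L h″ v∈ v∈″))))
  kept s h s′ h′ u∈ v∈ h≢h′ (_ , h″ , inj₂ (u∈″ , v∈″)) =
    h≢h′ (trans (proj₂ (segment-unique s h L h″ u∈ u∈″))
                (sym (proj₂ (segment-unique s′ h′ K h″ v∈ v∈″))))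

  minorEdge : ∀ s h s′ h′ {u v} → u ∈ segment s h → v ∈ segment s′ h′ → h ≢ h′ →
              Adj G u v → MinorEdge P Deleted (segment s h) (segment s′ h′)
  minorEdge s h s′ h′ u∈ v∈ h≢h′ a =
    _ , _ , u∈ , v∈ , a , kept s h s′ h′ u∈ v∈ h≢h′ , kept s′ h′ s h v∈ u∈ (h≢h′ ∘ sym)

  no-minorEdge : ∀ h → ¬ MinorEdge P Deleted (segment K h) (segment L h)
  no-minorEdge h (_ , _ , u∈ , v∈ , a , ¬deleted , _) = ¬deleted (a , h , inj₁ (u∈ , v∈))

  cut-segments : ∀ {s} pre {x post} → verts P (index s) ≡ pre ++ x ∷ post →
                 cut s ≡ suc (length pre) → segment s front ≡ pre ++ [ x ] × segment s back ≡ post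
  cut-segments pre {post = post} eq c =
    trans (cong₂ take c eq) (take-split pre post) , trans (cong₂ drop c eq) (drop-split pre post)

  module _ s pre {x post} (eq : verts P (index s) ≡ pre ++ x ∷ post)
           (c : cut s ≡ suc (length pre)) where

    cut∈front : x ∈ segment s front
    cut∈front = subst (x ∈_) (sym (proj₁ (cut-segments pre eq c))) (∈-++⁺ʳ pre (here refl))

    ∈-cut-back : ∀ {z} → z ∈ post → z ∈ segment s back
    ∈-cut-back = subst (_ ∈_) (sym (proj₂ (cut-segments pre eq c)))

  cut-minorEdge : ∀ s pre {x post z} → verts P (index s) ≡ pre ++ x ∷ post →
                  cut s ≡ suc (length pre) → z ∈ post →
                  MinorEdge P Deleted (segment s front) (segment s back)
  cut-minorEdge s pre {post = []}    eq c ()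
  cut-minorEdge s pre {post = _ ∷ _} eq c _ =
    minorEdge s front s back (cut∈front s pre eq c) (∈-cut-back s pre eq c (here refl)) (λ ())
              (Linked-step pre (path-linked P eq))

module _ {n} {G : Graph n} {t} (P : Linkage G t) where

  XMinor⇒crossing : HasXMinor P → ∃ λ k → ∃ λ l → k ≢ l × Crossing P k l
  XMinor⇒crossing (k , l , k≢l , m , m′ , _ , _ , _ , _ , _ , _ , _ , _ ,
                   (x , w , x∈Ak , w∈Bl , axw , _) , (z , y , z∈Bk , y∈Al , azy , _) , _ , _) =
    k , l , k≢l , crossing (cut-Before m x∈Ak z∈Bk) (cut-Before m′ y∈Al w∈Bl) axw (Adj-sym G azy)
    where
      cut-Before : ∀ m {xs : List (Fin n)} {u v} → u ∈ take m xs → v ∈ drop m xs → Before xs u v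
      cut-Before m {xs} u∈ v∈ =
        subst (λ ys → Before ys _ _) (take++drop≡id m xs) (∈-++-Before u∈ v∈)

  crossing⇒XMinor : ∀ {k l} → k ≢ l → Crossing P k l → HasXMinor P
  crossing⇒XMinor {k} {l} k≢l (crossing (before A ek z∈R) (before C el w∈S) axw ayz) =
    k , l , k≢l , m , m′ , z<s , split<length A ek z∈R , z<s , split<length C el w∈S ,
    Deleted , Deleted-rung ,
    cut-minorEdge K A ek refl z∈R , cut-minorEdge L C el refl w∈S ,
    minorEdge K front L back (cut∈front K A ek refl) (∈-cut-back L C el refl w∈S) (λ ()) axw ,
    minorEdge K back L front (∈-cut-back K A ek refl z∈R) (cut∈front L C el refl) (λ ())
              (Adj-sym G ayz) ,
    no-minorEdge front , no-minorEdge back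
    where
      m = suc (length A)
      m′ = suc (length C)
      open Contraction P k≢l m m′

  rigid⇒¬XMinor : ∀ {α β} → IsRigid α β P → ¬ HasXMinor P
  rigid⇒¬XMinor rigid x with k , l , k≢l , c ← XMinor⇒crossing x = rigid⇒¬crossing P rigid k≢l c

-- Linkages of order two

module _ {n} {G : Graph n} {α β : VSet n} {t s} (P : Linkage G t) (Q : Linkage G s)
         (abP : IsABLinkage α β P) (abQ : IsABLinkage α β Q) where

  open Equivalence

  stops⇒equal : ∀ {i j} pre x {post} → verts P i ≡ pre ++ x ∷ post → verts Q j ≡ pre ++ [ x ] →
                verts Q j ≡ verts P i
  stops⇒equal {i} {j} pre x {post} ep eq =
    trans eq (sym (trans ep (cong (λ r → pre ++ x ∷ r) post≡[])))
    where
      x-last : x ≡ last (path P i)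
      x-last with i′ , x≡ ← to (proj₂ abP x) (from (proj₂ abQ x) (j , sym (last-≡ (path Q j) pre eq)))
             with refl ← disjoint P i′ i x (subst (_∈ verts P i′) (sym x≡) (last∈ (path P i′)))
                                           (split-∈ pre ep)
             = x≡
      post≡[] : post ≡ []
      post≡[] with ys , ey ← toList-last (path P i) =
        proj₂ (split-unique pre ys (path-unique P ep)
                 (trans (sym ep) (subst (λ z → verts P i ≡ ys ++ [ z ]) (sym x-last) ey)))

  module _ (¬X : ¬ HasXMinor P) {i i′ : Fin t} {j j′ : Fin s} (i≢i′ : i ≢ i′) (j≢j′ : j ≢ j′)
           (covers : ∀ v → v ∈ verts P i ⊎ v ∈ verts P i′) where

    private
      disjointQ : ∀ {v} → v ∈ verts Q j → v ∈ verts Q j′ → ⊥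
      disjointQ v∈ v∈′ = j≢j′ (disjoint Q j j′ _ v∈ v∈′)

      on-walk : ∀ {k} pre {x rest v} → verts Q k ≡ pre ++ x ∷ rest → v ∈ pre ++ x ∷ rest →
                v ∈ verts Q k
      on-walk pre eq = subst (_ ∈_) (sym eq)

      in-i : ∀ {v} → v ∉ verts P i′ → v ∈ verts P i
      in-i {v} v∉ with covers v
      ... | inj₁ v∈ = v∈
      ... | inj₂ v∈ = ⊥-elim (v∉ v∈)

      in-i′ : ∀ {v} → v ∉ verts P i → v ∈ verts P i′
      in-i′ {v} v∉ with covers v
      ... | inj₁ v∈ = ⊥-elim (v∉ v∈)
      ... | inj₂ v∈ = v∈

      walked-or-ahead : ∀ {k l} pre {x post rest v} → verts P k ≡ pre ++ x ∷ post →
                        verts Q l ≡ pre ++ x ∷ rest → v ∈ verts P k → v ∈ verts Q l ⊎ v ∈ post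
      walked-or-ahead pre ep eq v∈ with ∈-split⁻ pre (subst (_ ∈_) ep v∈)
      ... | inj₁ v∈q    = inj₁ (on-walk pre eq v∈q)
      ... | inj₂ v∈post = inj₂ v∈post

    follows⇒equal : Follow G (verts P i) (verts Q j) → Follow G (verts P i′) (verts Q j′) →
                    verts Q j ≡ verts P i
    follows⇒equal (stops pre x ep eq) _ = stops⇒equal pre x ep eq
    follows⇒equal (departs pre x w ep eq _ w∉) (stops pre′ y ep′ eq′) =
      ⊥-elim (disjointQ (on-walk pre eq (∈-++⁺ʳ pre (there (here refl))))
                        (subst (w ∈_) (sym (stops⇒equal pre′ y ep′ eq′)) (in-i′ w∉)))
    follows⇒equal (departs pre x w ep eq axw w∉) (departs pre′ y z ep′ eq′ ayz z∉)
      with walked-or-ahead pre ep eq (in-i z∉) | walked-or-ahead pre′ ep′ eq′ (in-i′ w∉)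
    ... | inj₁ z∈q | _ =
      ⊥-elim (disjointQ z∈q (on-walk pre′ eq′ (∈-++⁺ʳ pre′ (there (here refl)))))
    ... | _ | inj₁ w∈q′ =
      ⊥-elim (disjointQ (on-walk pre eq (∈-++⁺ʳ pre (there (here refl)))) w∈q′)
    ... | inj₂ z-ahead | inj₂ w-ahead =
      ⊥-elim (¬X (crossing⇒XMinor P i≢i′
                   (crossing (before pre ep z-ahead) (before pre′ ep′ w-ahead) axw ayz)))

SameSubgraph-from : ∀ {n} {G : Graph n} {t s} (P : Linkage G t) (Q : Linkage G s) →
                    (∀ i → ∃ λ j → verts Q j ≡ verts P i) →
                    (∀ j → ∃ λ i → verts Q j ≡ verts P i) → SameSubgraph P Q
SameSubgraph-from {n} P Q P→Q Q→P =
  (λ v → mk⇔ (toQ (v ∈_)) (toP (v ∈_))) ,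
  (λ u v → mk⇔ (toQ (edge u v)) (toP (edge u v)))
  where
    edge : Fin n → Fin n → List (Fin n) → Set
    edge u v xs = Consec xs u v ⊎ Consec xs v u
    toQ : (F : List (Fin n) → Set) → (∃ λ i → F (verts P i)) → ∃ λ j → F (verts Q j)
    toQ F (i , f) with j , eq ← P→Q i = j , subst F (sym eq) f
    toP : (F : List (Fin n) → Set) → (∃ λ j → F (verts Q j)) → ∃ λ i → F (verts P i)
    toP F (j , f) with i , eq ← Q→P j = i , subst F eq f

module _ {n} {G : Graph n} {α β : VSet n} (P : Linkage G 2) (abP : IsABLinkage α β P)
         (spanning : Spanning P) (chordless : Chordless P) (¬X : ¬ HasXMinor P) where

  open Equivalence

  covers : ∀ v → v ∈ verts P zero ⊎ v ∈ verts P (suc zero)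
  covers v with spanning v
  ... | zero     , v∈ = inj₁ v∈
  ... | suc zero , v∈ = inj₂ v∈

  module _ {s} (Q : Linkage G s) (abQ : IsABLinkage α β Q) where

    partner-head : ∀ i → ∃ λ j → head (path P i) ≡ head (path Q j)
    partner-head i = to (proj₁ abQ _) (from (proj₁ abP _) (i , refl))

    partner : Fin 2 → Fin s
    partner i = proj₁ (partner-head i)

    partner-injective : partner zero ≢ partner (suc zero)
    partner-injective eq with () ← head-injective P
      (trans (proj₂ (partner-head zero))
             (trans (cong (head ∘ path Q) eq) (sym (proj₂ (partner-head (suc zero))))))

    partner-follows : ∀ i → Follow G (verts P i) (verts Q (partner i))
    partner-follows i =
      follow P chordless (path Q (partner i)) (isPath Q (partner i)) (sym (proj₂ (partner-head i)))

    partner-equal : ∀ i → verts Q (partner i) ≡ verts P i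
    partner-equal zero =
      follows⇒equal P Q abP abQ ¬X (λ ()) partner-injective covers
        (partner-follows zero) (partner-follows (suc zero))
    partner-equal (suc zero) =
      follows⇒equal P Q abP abQ ¬X (λ ()) (partner-injective ∘ sym) (swap ∘ covers)
        (partner-follows (suc zero)) (partner-follows zero)

    partner-onto : ∀ j → ∃ λ i → verts Q j ≡ verts P i
    partner-onto j with i , eq ← to (proj₁ abP _) (from (proj₁ abQ _) (j , refl))
                   with refl ← head-injective Q (trans eq (proj₂ (partner-head i))) =
      i , partner-equal i

  two-paths-rigid : IsRigid α β P
  two-paths-rigid = abP , λ _ Q abQ →
    SameSubgraph-from P Q (λ i → partner Q abQ i , partner-equal Q abQ i) (partner-onto Q abQ)

theorem2p15 :
    (∀ {n} (G : Graph n) (α β : VSet n) (t : ℕ) (P : Linkage G t) →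
       IsABLinkage α β P → IsRigid α β P → Chordless P × ¬ HasXMinor P) ×
    (∀ {n} (G : Graph n) (α β : VSet n) (P : Linkage G 2) →
       IsABLinkage α β P → Spanning P → Chordless P → ¬ HasXMinor P →
       IsRigid α β P)
theorem2p15 =
  (λ G α β t P _ rigid → rigid⇒chordless P rigid , rigid⇒¬XMinor P rigid) ,
  (λ G α β P abP spanning chordless ¬X → two-paths-rigid P abP spanning chordless ¬X)
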